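{- Fix $k \ge 2$, $n \ge 1$, and $D_k \in \mathcal{D}_k$. Let $H$ be a $k$-partite $k$-uniform hypergraph with parts $X_1,\dots,X_k$, each of size $n$. If $H$ has more than $kn^{k-1}$ edges, then $H$ contains a copy of $D_k$. Equivalently, $z(n, D_k) \le kn^{k-1}$.
   Context: The family $\mathcal{D}_k$ of special $k$-clusters is defined inductively: $\mathcal{D}_2 = \{D_2\}$ where $D_2$ is the graph path with three edges (4 vertices). For $k \ge 3$, $\mathcal{D}_k$ consists of all $k$-uniform hypergraphs obtained as follows: take any $D_{k-1} \in \mathcal{D}_{k-1}$ (which has $2(k-1)$ vertices and two disjoint edges $a$ and $b$), add two new vertices $x,y$, enlarge every edge of $D_{k-1}$ by adding $x$, and add one more edge $a \cup \{y\}$. Thus each member of $\mathcal{D}_k$ has $2k$ vertices and $k+1$ edges, two of which are disjoint. The Zarankiewicz number $z(n,F)$ is the maximum number of edges in a $k$-partite $k$-uniform hypergraph with parts of size $n$ containing no copy (subhypergraph isomorphic to) $F$. -}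

module Defs where

open import Data.Nat using (ℕ; zero; suc; _+_; _*_; _∸_; _^_; _<_)
open import Data.Fin using (Fin)
open import Data.Vec using (Vec; lookup)
open import Data.List using (List; []; _∷_; map; _++_; [_]; length)
open import Data.List.Membership.Propositional using (_∈_)
open import Data.List.Relation.Unary.Unique.Propositional using (Unique)
open import Data.Product using (Σ; ∃; _×_; _,_; proj₁; proj₂)
open import Relation.Binary.PropositionalEquality using (_≡_)

-- A (labelled) special k-cluster has vertex set {0, …, 2k-1} ⊆ ℕ and its
-- edges are given as lists of vertices (each edge read as a set).
-- `Special k E a b` : E is the edge list of a member of 𝒟_k, and a, b are
-- its two designated disjoint edges (either of them may play the role of
-- `a` in the next step, via `swap`).
--   D_2 : path 0-1-2-3 with edges {0,1},{1,2},{2,3}; a = {0,1}, b = {2,3}.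
--   step: from D_k on {0..2k-1}, new vertices x = 2k, y = 2k+1;
--         every edge enlarged by x, plus the edge a ∪ {y}.
--         New disjoint edges: a ∪ {y} and b ∪ {x}.

data Special : ℕ → List (List ℕ) → List ℕ → List ℕ → Set where
  base : Special 2 ((0 ∷ 1 ∷ []) ∷ (1 ∷ 2 ∷ []) ∷ (2 ∷ 3 ∷ []) ∷ [])
                   (0 ∷ 1 ∷ []) (2 ∷ 3 ∷ [])
  step : ∀ {k E a b} → Special k E a b →
         Special (suc k)
                 (map (λ e → (2 * k) ∷ e) E ++ [ suc (2 * k) ∷ a ])
                 (suc (2 * k) ∷ a) ((2 * k) ∷ b)
  swap : ∀ {k E a b} → Special k E a b → Special k E b a

InDk : ℕ → List (List ℕ) → Set
InDk k E = ∃ λ a → ∃ λ b → Special k E a b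

-- Vertices: Fin k × Fin n (part i, index j).  An edge picks one vertex in
-- each part, so it is a vector e : Vec (Fin n) k; its vertex set is
-- {(i , lookup e i) | i : Fin k}.

PEdge : ℕ → ℕ → Set
PEdge k n = Vec (Fin n) k

record PartiteHypergraph (k n : ℕ) : Set where
  field
    edges  : List (PEdge k n)
    unique : Unique edges
open PartiteHypergraph public

numEdges : ∀ {k n} → PartiteHypergraph k n → ℕ
numEdges H = length (edges H)

_∈ᵉ_ : ∀ {k n} → Fin k × Fin n → PEdge k n → Set
w ∈ᵉ e = proj₂ w ≡ lookup e (proj₁ w)

MapsOnto : ∀ {k n} → (ℕ → Fin k × Fin n) → List ℕ → PEdge k n → Set
MapsOnto φ f e =
  (∀ {v} → v ∈ f → φ v ∈ᵉ e) ×
  (∀ (i : Fin _) → ∃ λ v → v ∈ f × φ v ≡ (i , lookup e i))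

ContainsCopy : ∀ {k n} → PartiteHypergraph k n → ℕ → List (List ℕ) → Set
ContainsCopy {k} {n} H m E =
  Σ (ℕ → Fin k × Fin n) λ φ →
    (∀ {u v} → u < m → v < m → φ u ≡ φ v → u ≡ v) ×
    (∀ {f} → f ∈ E → ∃ λ e → e ∈ edges H × MapsOnto φ f e)

module Submission where

-- The proof follows the inductive construction of D_k.  Its engine is the
-- branching lemma: call an edge e of a (k+1)-partite hypergraph H branching
-- if another edge of H agrees with e on the last k parts but not on the
-- first.  A non-branching edge is determined by its trace on the last k
-- parts, so at most n^k edges do not branch.  Hence if |H| > n·m + n^k,
-- more than n·m edges branch, and by pigeonhole more than m of them share
-- their first vertex x.  Their traces form a k-partite hypergraph L with
-- |L| > m, and for every t ∈ L both x ∪ t and some y ∪ t with y ≠ x are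
-- edges of H.  Since n·(k·n^(k-1)) + n^k = (k+1)·n^k, induction finds D_k in
-- L; sending the new vertices of D_(k+1) to x and to the y lying over the
-- image of the designated edge a extends it to a copy of D_(k+1) in H.  The
-- base D_2 (a path with three edges) is the branching lemma for k = m = 1.

open import Defs
open import Data.Nat using (ℕ; zero; suc; _+_; _*_; _∸_; _^_; _<_; _≤_; z≤n; s≤s; z<s; _<?_)
open import Data.Nat.Properties
  using (≤-trans; ≤-refl; <-irrefl; <-asym; n<1+n; 1+n≢n; <⇒≤; m≤n⇒m≤1+n; n≤1+n; ≮⇒≥; <⇒≱; +-mono-≤; +-monoʳ-≤; +-cancelʳ-<; *-suc; *-zeroʳ; +-suc; module ≤-Reasoning)
import Data.Nat as ℕ
open import Data.Nat.Tactic.RingSolver using (solve-∀)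
open import Data.Fin using (Fin; zero; suc)
import Data.Fin.Properties as Fin
open import Data.Vec using (Vec; []; _∷_; head; tail; lookup)
import Data.Vec.Properties as Vec
open import Data.List using (List; []; _∷_; map; filter; length; allFin; _++_; [_])
open import Data.List.Properties using (length-map; length-tabulate)
open import Data.List.Relation.Unary.All using (All; []; _∷_)
import Data.List.Relation.Unary.All as All
open import Data.List.Relation.Unary.All.Properties using (all-filter; map⁺)
open import Data.List.Relation.Unary.Any using (Any; here; there; any?)
import Data.List.Relation.Unary.Any as Any
open import Data.List.Relation.Unary.AllPairs using ([]; _∷_)
open import Data.List.Relation.Unary.Unique.Propositional using (Unique)
import Data.List.Relation.Unary.Unique.Propositional.Properties as Unique
open import Data.List.Relation.Binary.Sublist.Propositional.Properties using (filter-⊆; length-mono-≤)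
import Data.List.Relation.Binary.Sublist.Propositional.Properties as Sublist
open import Data.List.Membership.Propositional using (_∈_; find; lose)
open import Data.List.Membership.Propositional.Properties using (∈-filter⁻; ∈-map⁻; ∈-map⁺; ∈-++⁻; ∈-++⁺ˡ; ∈-++⁺ʳ; ∈-allFin)
open import Data.Product using (Σ; ∃; ∃₂; _×_; _,_; proj₁; proj₂)
open import Data.Sum using (inj₁; inj₂)
open import Data.Empty using (⊥-elim)
open import Function using (_∘_; id)
open import Level using (0ℓ)
open import Relation.Nullary using (¬_; yes; no; ¬?)
open import Relation.Nullary.Decidable using (_×-dec_)
open import Relation.Unary using (Pred; Decidable)
open import Relation.Unary.Properties using (∁?)
open import Relation.Binary.Definitions using (DecidableEquality)
open import Relation.Binary.PropositionalEquality using (_≡_; _≢_; refl; sym; trans; cong; cong₂; subst)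

length-filter-split : ∀ {A : Set} {P : Pred A 0ℓ} (P? : Decidable P) xs →
                      length (filter P? xs) + length (filter (∁? P?) xs) ≡ length xs
length-filter-split P? [] = refl
length-filter-split P? (x ∷ xs) with P? x
... | yes _ = cong suc (length-filter-split P? xs)
... | no  _ = trans (+-suc _ _) (cong suc (length-filter-split P? xs))

module Fibres {A B : Set} (_≟_ : DecidableEquality B) (h : A → B) where

  fibre : B → List A → List A
  fibre b = filter (λ a → h a ≟ b)

  fibre-bound : ∀ m vs xs → All (λ a → h a ∈ vs) xs →
                (∀ b → length (fibre b xs) ≤ m) → length xs ≤ length vs * m
  fibre-bound m []       []      _        _     = z≤n
  fibre-bound m []       (_ ∷ _) (() ∷ _) _
  fibre-bound m (v ∷ vs) xs      into     small = begin
      length xs                                     ≡⟨ sym (length-filter-split (λ a → h a ≟ v) xs) ⟩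
      length (fibre v xs) + length rest             ≤⟨ +-mono-≤ (small v) (fibre-bound m vs rest into-vs small-rest) ⟩
      m + length vs * m                             ∎
    where
    open ≤-Reasoning
    rest : List A
    rest = filter (∁? (λ a → h a ≟ v)) xs
    into-vs : All (λ a → h a ∈ vs) rest
    into-vs = All.tabulate λ a∈ →
      let (a∈xs , ha≢v) = ∈-filter⁻ (∁? (λ a → h a ≟ v)) a∈ in Any.tail ha≢v (All.lookup into a∈xs)
    -- the fibres of rest are sublists of those of xs
    small-rest : ∀ b → length (fibre b rest) ≤ m
    small-rest b = ≤-trans
      (length-mono-≤ (Sublist.filter⁺ (λ a → h a ≟ b) (λ a → h a ≟ b) (λ { refl p → p }) (filter-⊆ _ xs)))
      (small b)

fibre-bound-Fin : ∀ {A : Set} {n} (h : A → Fin n) m xs →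
                  (∀ b → length (Fibres.fibre Fin._≟_ h b xs) ≤ m) → length xs ≤ n * m
fibre-bound-Fin {n = n} h m xs small =
  subst (λ l → length xs ≤ l * m) (length-tabulate {n = n} id)
    (Fibres.fibre-bound Fin._≟_ h m (allFin n) xs (All.tabulate (λ _ → ∈-allFin _)) small)

pigeonhole : ∀ {A : Set} {n} m (h : A → Fin n) xs → n * m < length xs →
             ∃ λ b → m < length (Fibres.fibre Fin._≟_ h b xs)
pigeonhole m h xs big with Fin.any? (λ b → m <? length (Fibres.fibre Fin._≟_ h b xs))
... | yes large = large
... | no  none  = ⊥-elim (<⇒≱ big (fibre-bound-Fin h m xs (λ b → ≮⇒≥ (λ large → none (b , large)))))

map-unique-on : ∀ {A B : Set} {Q : A → Set} (f : A → B) →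
                (∀ {a a′} → Q a → Q a′ → f a ≡ f a′ → a ≡ a′) →
                ∀ {xs} → All Q xs → Unique xs → Unique (map f xs)
map-unique-on f inj []       []         = []
map-unique-on f inj (q ∷ qs) (x∉ ∷ xs!) =
  map⁺ (All.zipWith (λ (q′ , x≢) → x≢ ∘ inj q q′) (qs , x∉)) ∷ map-unique-on f inj qs xs!

tail-injective-on-fibre : ∀ {k n} {b : Fin n} {e e′ : Vec (Fin n) (suc k)} →
                          head e ≡ b → head e′ ≡ b → tail e ≡ tail e′ → e ≡ e′
tail-injective-on-fibre {e = _ ∷ _} {e′ = _ ∷ _} refl refl refl = refl

unique-vectors-bound : ∀ k {n} (xs : List (Vec (Fin n) k)) → Unique xs → length xs ≤ n ^ k
unique-vectors-bound zero    []             _                 = z≤n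
unique-vectors-bound zero    ([] ∷ [])      _                 = s≤s z≤n
unique-vectors-bound zero    ([] ∷ [] ∷ _)  ((≢[] ∷ _) ∷ _) = ⊥-elim (≢[] refl)
unique-vectors-bound (suc k) {n} xs xs! = fibre-bound-Fin head (n ^ k) xs fibre-small
  where
  open Fibres Fin._≟_ head
  -- the tails of the edges through a fixed first vertex form a simple k-partite hypergraph
  fibre-small : ∀ b → length (fibre b xs) ≤ n ^ k
  fibre-small b = subst (_≤ n ^ k) (length-map tail (fibre b xs))
    (unique-vectors-bound k _
      (map-unique-on tail tail-injective-on-fibre (all-filter _ xs) (Unique.filter⁺ _ xs!)))

Branches : ∀ {k n} → List (Vec (Fin n) (suc k)) → Vec (Fin n) (suc k) → Set
Branches es e = Any (λ e′ → tail e′ ≡ tail e × head e′ ≢ head e) es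

branches? : ∀ {k n} (es : List (Vec (Fin n) (suc k))) → Decidable (Branches es)
branches? es e = any? (λ e′ → Vec.≡-dec Fin._≟_ (tail e′) (tail e) ×-dec ¬? (head e′ Fin.≟ head e)) es

-- Non-branching edges are determined by their tails, so there are at most n^k of them.
non-branching-bound : ∀ {k n} (es : List (Vec (Fin n) (suc k))) → Unique es →
                      length (filter (∁? (branches? es)) es) ≤ n ^ k
non-branching-bound {k} {n} es es! = subst (_≤ n ^ k) (length-map tail lonely)
  (unique-vectors-bound k _
    (map-unique-on tail tail-injective-on-lonely
      (All.tabulate (∈-filter⁻ (∁? (branches? es)))) (Unique.filter⁺ _ es!)))
  where
  lonely : List (Vec (Fin n) (suc k))
  lonely = filter (∁? (branches? es)) es
  tail-injective-on-lonely : ∀ {e e′} → e ∈ es × ¬ Branches es e → e′ ∈ es × ¬ Branches es e′ →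
                             tail e ≡ tail e′ → e ≡ e′
  tail-injective-on-lonely {e} {e′} (_ , lonely-e) (e′∈ , _) same-tail with head e Fin.≟ head e′
  ... | yes same-head = tail-injective-on-fibre same-head refl same-tail
  ... | no  head≢     = ⊥-elim (lonely-e (lose e′∈ (sym same-tail , head≢ ∘ sym)))

branching-lemma : ∀ {k n} m (H : PartiteHypergraph (suc k) n) → n * m + n ^ k < numEdges H →
  Σ (Fin n) λ x → Σ (PartiteHypergraph k n) λ L → m < numEdges L ×
    (∀ {t} → t ∈ edges L → (x ∷ t) ∈ edges H × ∃ λ y → y ≢ x × (y ∷ t) ∈ edges H)
branching-lemma {k} {n} m H big = x , L , subst (m <_) (sym (length-map tail star)) many-at-x , link
  where
  es = edges H
  branching = filter (branches? es) es
  many-branching : n * m < length branching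
  many-branching = +-cancelʳ-< _ _ _ (begin-strict
    n * m + length (filter (∁? (branches? es)) es) ≤⟨ +-monoʳ-≤ (n * m) (non-branching-bound es (unique H)) ⟩
    n * m + n ^ k                                  <⟨ big ⟩
    length es                                      ≡⟨ sym (length-filter-split (branches? es) es) ⟩
    length branching + length (filter (∁? (branches? es)) es) ∎)
    where open ≤-Reasoning
  open Fibres Fin._≟_ head
  x = proj₁ (pigeonhole m head branching many-branching)
  many-at-x = proj₂ (pigeonhole m head branching many-branching)
  star = fibre x branching
  L : PartiteHypergraph k n
  L = record { edges  = map tail star
             ; unique = map-unique-on tail tail-injective-on-fibre (all-filter _ branching)
                          (Unique.filter⁺ _ (Unique.filter⁺ _ (unique H))) }
  link : ∀ {t} → t ∈ map tail star → (x ∷ t) ∈ es × ∃ λ y → y ≢ x × (y ∷ t) ∈ es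
  link t∈ with ∈-map⁻ tail t∈
  ... | (_ ∷ _) , e∈star , refl with ∈-filter⁻ (λ e → head e Fin.≟ x) {xs = branching} e∈star
  ... | e∈branching , refl with ∈-filter⁻ (branches? es) {xs = es} e∈branching
  ... | e∈es , e-branches with find e-branches
  ... | (y ∷ _) , y∈ , refl , y≢x = e∈es , y , y≢x , y∈

-- The threshold (k+1)·n^k of 𝒟_(k+1) is n·(threshold k·n^(k-1) of 𝒟_k) + n^k,
-- which is exactly the hypothesis of the branching lemma.
threshold-step : ∀ k n → n * (k * n ^ (k ∸ 1)) + n ^ k ≡ suc k * n ^ k
threshold-step zero    n = cong (_+ 1) (*-zeroʳ n)
threshold-step (suc j) n = identity j n (n ^ j)
  where
  identity : ∀ j n p → n * (suc j * p) + n * p ≡ suc (suc j) * (n * p)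
  identity = solve-∀

designated-edges : ∀ {k E a b} → Special k E a b → a ∈ E × b ∈ E
designated-edges base     = here refl , there (there (here refl))
designated-edges (step {k} {E} s) =
  ∈-++⁺ʳ (map ((2 * k) ∷_) E) (here refl) , ∈-++⁺ˡ (∈-map⁺ ((2 * k) ∷_) (proj₂ (designated-edges s)))
designated-edges (swap s) = proj₂ (designated-edges s) , proj₁ (designated-edges s)

below-step : ∀ k {v} → v ≤ suc (2 * k) → v < 2 * suc k
below-step k {v} v≤ = subst (v <_) (sym (*-suc 2 k)) (s≤s v≤)

vertices-below : ∀ {k E a b} → Special k E a b → ∀ {f} → f ∈ E → ∀ {v} → v ∈ f → v < 2 * k
vertices-below base (here refl)                 (here refl)         = s≤s z≤n
vertices-below base (here refl)                 (there (here refl)) = s≤s (s≤s z≤n)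
vertices-below base (there (here refl))         (here refl)         = s≤s (s≤s z≤n)
vertices-below base (there (here refl))         (there (here refl)) = s≤s (s≤s (s≤s z≤n))
vertices-below base (there (there (here refl))) (here refl)         = s≤s (s≤s (s≤s z≤n))
vertices-below base (there (there (here refl))) (there (here refl)) = s≤s (s≤s (s≤s (s≤s z≤n)))
vertices-below (swap s) = vertices-below s
vertices-below (step {k} {E} s) f∈ v∈ with ∈-++⁻ (map ((2 * k) ∷_) E) f∈
... | inj₁ f∈xE with ∈-map⁻ ((2 * k) ∷_) f∈xE
...   | _ , f∈E , refl with v∈
...     | here refl   = below-step k (n≤1+n _)
...     | there v∈f   = below-step k (m≤n⇒m≤1+n (<⇒≤ (vertices-below s f∈E v∈f)))
vertices-below (step {k} s) f∈ v∈ | inj₂ (here refl) with v∈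
... | here refl = below-step k ≤-refl
... | there v∈a = below-step k (m≤n⇒m≤1+n (<⇒≤ (vertices-below s (proj₁ (designated-edges s)) v∈a)))

InjectiveBelow : ∀ {A : Set} → ℕ → (ℕ → A) → Set
InjectiveBelow m φ = ∀ {u v} → u < m → v < m → φ u ≡ φ v → u ≡ v

data Position (N : ℕ) : ℕ → Set where
  old  : ∀ {v} → v < N → Position N v
  newX : Position N N
  newY : Position N (suc N)

classify : ∀ N {v} → v < 2 + N → Position N v
classify zero    {0}           _              = newX
classify zero    {1}           _              = newY
classify zero    {suc (suc _)} (s≤s (s≤s ()))
classify (suc N) {zero}        _              = old z<s
classify (suc N) {suc v}       (s≤s v<)       = shift-position (classify N v<)
  where
  shift-position : Position N v → Position (suc N) (suc v)
  shift-position (old v<N) = old (s≤s v<N)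
  shift-position newX      = newX
  shift-position newY      = newY

module Extension {k n : ℕ} (φ : ℕ → Fin k × Fin n) (N : ℕ) (x y : Fin n) where

  shift : Fin k × Fin n → Fin (suc k) × Fin n
  shift p = suc (proj₁ p) , proj₂ p

  extend : ℕ → Fin (suc k) × Fin n
  extend v with v <? N
  ... | yes _ = shift (φ v)
  ... | no  _ with v ℕ.≟ N
  ...   | yes _ = zero , x
  ...   | no  _ = zero , y

  image : ∀ {v} → Position N v → Fin (suc k) × Fin n
  image {v} (old _) = shift (φ v)
  image newX        = zero , x
  image newY        = zero , y

  extend-on : ∀ {v} (p : Position N v) → extend v ≡ image p
  extend-on {v} (old v<N) with v <? N
  ... | yes _   = refl
  ... | no  v≮N = ⊥-elim (v≮N v<N)
  extend-on newX with N <? N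
  ... | yes N<N = ⊥-elim (<-irrefl refl N<N)
  ... | no  _ with N ℕ.≟ N
  ...   | yes _ = refl
  ...   | no  N≢N = ⊥-elim (N≢N refl)
  extend-on newY with suc N <? N
  ... | yes N+1<N = ⊥-elim (<-asym N+1<N (n<1+n N))
  ... | no  _ with suc N ℕ.≟ N
  ...   | yes N+1≡N = ⊥-elim (1+n≢n N+1≡N)
  ...   | no  _     = refl

  image-injective : x ≢ y → InjectiveBelow N φ →
                    ∀ {u v} (p : Position N u) (q : Position N v) → image p ≡ image q → u ≡ v
  image-injective x≢y φ-inj (old u<N) (old v<N) eq = φ-inj u<N v<N (cong₂ _,_ (Fin.suc-injective (cong proj₁ eq)) (cong proj₂ eq))
  image-injective x≢y φ-inj (old _)   newX      ()
  image-injective x≢y φ-inj (old _)   newY      ()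
  image-injective x≢y φ-inj newX      (old _)   ()
  image-injective x≢y φ-inj newY      (old _)   ()
  image-injective x≢y φ-inj newX      newX      _  = refl
  image-injective x≢y φ-inj newY      newY      _  = refl
  image-injective x≢y φ-inj newX      newY      eq = ⊥-elim (x≢y (cong proj₂ eq))
  image-injective x≢y φ-inj newY      newX      eq = ⊥-elim (x≢y (sym (cong proj₂ eq)))

  extend-injective : x ≢ y → InjectiveBelow N φ → InjectiveBelow (2 + N) extend
  extend-injective x≢y φ-inj u< v< eq =
    image-injective x≢y φ-inj (classify N u<) (classify N v<)
      (trans (sym (extend-on (classify N u<))) (trans eq (extend-on (classify N v<))))

  extend-maps : ∀ {z w f} {e : Vec (Fin n) k} → extend z ≡ (zero , w) → (∀ {v} → v ∈ f → v < N) →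
                MapsOnto φ f e → MapsOnto extend (z ∷ f) (w ∷ e)
  extend-maps {z} {w} {f} {e} z↦w f-old (into , onto) = into′ , onto′
    where
    extend-old : ∀ {v} → v ∈ f → extend v ≡ shift (φ v)
    extend-old v∈f = extend-on (old (f-old v∈f))
    into′ : ∀ {v} → v ∈ z ∷ f → extend v ∈ᵉ (w ∷ e)
    into′ (here refl) rewrite z↦w = refl
    into′ (there v∈f) rewrite extend-old v∈f = into v∈f
    onto′ : ∀ i → ∃ λ v → v ∈ z ∷ f × extend v ≡ (i , lookup (w ∷ e) i)
    onto′ zero    = z , here refl , z↦w
    onto′ (suc i) with onto i
    ... | v , v∈f , φv≡ = v , there v∈f , trans (extend-old v∈f) (cong shift φv≡)

two-distinct : ∀ {A : Set} {xs : List A} → Unique xs → 1 < length xs →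
               ∃₂ λ a b → a ≢ b × a ∈ xs × b ∈ xs
two-distinct {xs = a ∷ b ∷ _} ((a≢b ∷ _) ∷ _) _           = a , b , a≢b , here refl , there (here refl)
two-distinct {xs = _ ∷ []}    _                 (s≤s ())

-- The path y a x b (edges ya, ax, xb) laid out along D_2 = 0-1-2-3.
path-embedding : ∀ {n} → Fin n → Fin n → Fin n → Fin n → ℕ → Fin 2 × Fin n
path-embedding y a x b 0 = zero , y
path-embedding y a x b 1 = suc zero , a
path-embedding y a x b 2 = zero , x
path-embedding y a x b _ = suc zero , b

path-embedding-injective : ∀ {n} {y a x b : Fin n} → y ≢ x → a ≢ b →
                           InjectiveBelow 4 (path-embedding y a x b)
path-embedding-injective y≢x a≢b {0} {0} _ _ _  = refl
path-embedding-injective y≢x a≢b {0} {2} _ _ eq = ⊥-elim (y≢x (cong proj₂ eq))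
path-embedding-injective y≢x a≢b {1} {1} _ _ _  = refl
path-embedding-injective y≢x a≢b {1} {3} _ _ eq = ⊥-elim (a≢b (cong proj₂ eq))
path-embedding-injective y≢x a≢b {2} {0} _ _ eq = ⊥-elim (y≢x (sym (cong proj₂ eq)))
path-embedding-injective y≢x a≢b {2} {2} _ _ _  = refl
path-embedding-injective y≢x a≢b {3} {1} _ _ eq = ⊥-elim (a≢b (sym (cong proj₂ eq)))
path-embedding-injective y≢x a≢b {3} {3} _ _ _  = refl
path-embedding-injective y≢x a≢b {0} {1} _ _ ()
path-embedding-injective y≢x a≢b {0} {3} _ _ ()
path-embedding-injective y≢x a≢b {1} {0} _ _ ()
path-embedding-injective y≢x a≢b {1} {2} _ _ ()
path-embedding-injective y≢x a≢b {2} {1} _ _ ()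
path-embedding-injective y≢x a≢b {2} {3} _ _ ()
path-embedding-injective y≢x a≢b {3} {0} _ _ ()
path-embedding-injective y≢x a≢b {3} {2} _ _ ()
path-embedding-injective y≢x a≢b {suc (suc (suc (suc _)))} (s≤s (s≤s (s≤s (s≤s ())))) _ _
path-embedding-injective y≢x a≢b {_} {suc (suc (suc (suc _)))} _ (s≤s (s≤s (s≤s (s≤s ())))) _

D₂ : List (List ℕ)
D₂ = (0 ∷ 1 ∷ []) ∷ (1 ∷ 2 ∷ []) ∷ (2 ∷ 3 ∷ []) ∷ []

path-from-edges : ∀ {n} (H : PartiteHypergraph 2 n) {y a x b : Fin n} → y ≢ x → a ≢ b →
                  (y ∷ a ∷ []) ∈ edges H → (x ∷ a ∷ []) ∈ edges H → (x ∷ b ∷ []) ∈ edges H →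
                  ContainsCopy H 4 D₂
path-from-edges H {y} {a} {x} {b} y≢x a≢b ya xa xb =
  path-embedding y a x b , path-embedding-injective y≢x a≢b , onto-edge
  where
  onto-edge : ∀ {f} → f ∈ D₂ → ∃ λ e → e ∈ edges H × MapsOnto (path-embedding y a x b) f e
  onto-edge (here refl) = (y ∷ a ∷ []) , ya ,
    (λ { (here refl) → refl ; (there (here refl)) → refl }) ,
    (λ { zero → 0 , here refl , refl ; (suc zero) → 1 , there (here refl) , refl })
  onto-edge (there (here refl)) = (x ∷ a ∷ []) , xa ,
    (λ { (here refl) → refl ; (there (here refl)) → refl }) ,
    (λ { zero → 2 , there (here refl) , refl ; (suc zero) → 1 , here refl , refl })
  onto-edge (there (there (here refl))) = (x ∷ b ∷ []) , xb ,
    (λ { (here refl) → refl ; (there (here refl)) → refl }) ,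
    (λ { zero → 2 , here refl , refl ; (suc zero) → 3 , there (here refl) , refl })

path-copy : ∀ {n} (H : PartiteHypergraph 2 n) → 2 * n ^ 1 < numEdges H → ContainsCopy H 4 D₂
path-copy {n} H big with branching-lemma 1 H (subst (_< numEdges H) (sym (threshold-step 1 n)) big)
... | x , L , more , link with two-distinct (unique L) more
... | (a ∷ []) , (b ∷ []) , a≢b , a∈ , b∈ with link a∈ | link b∈
... | xa , y , y≢x , ya | xb , _ = path-from-edges H y≢x (a≢b ∘ cong (_∷ [])) ya xa xb

extend-copy : ∀ {k E a b n} → Special k E a b →
  (H : PartiteHypergraph (suc k) n) (L : PartiteHypergraph k n) (x : Fin n) →
  (∀ {t} → t ∈ edges L → (x ∷ t) ∈ edges H × ∃ λ y → y ≢ x × (y ∷ t) ∈ edges H) →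
  ContainsCopy L (2 * k) E →
  ContainsCopy H (2 * suc k) (map ((2 * k) ∷_) E ++ [ suc (2 * k) ∷ a ])
extend-copy {k} {E} {a} s H L x link (φ , φ-inj , φ-maps)
  with φ-maps (proj₁ (designated-edges s))
... | eₐ , eₐ∈L , a-onto with link eₐ∈L
... | _ , y , y≢x , yeₐ∈H = extend , injective , onto-edge
  where
  open Extension φ (2 * k) x y
  injective : InjectiveBelow (2 * suc k) extend
  injective {u} {v} u< v< = extend-injective (y≢x ∘ sym) φ-inj
    (subst (u <_) (*-suc 2 k) u<) (subst (v <_) (*-suc 2 k) v<)
  onto-edge : ∀ {f} → f ∈ map ((2 * k) ∷_) E ++ [ suc (2 * k) ∷ a ] →
              ∃ λ e → e ∈ edges H × MapsOnto extend f e
  onto-edge f∈ with ∈-++⁻ (map ((2 * k) ∷_) E) f∈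
  ... | inj₁ f∈xE with ∈-map⁻ ((2 * k) ∷_) f∈xE
  ...   | f , f∈E , refl with φ-maps f∈E
  ...     | e , e∈L , f-onto =
              (x ∷ e) , proj₁ (link e∈L) , extend-maps (extend-on newX) (vertices-below s f∈E) f-onto
  onto-edge f∈ | inj₂ (here refl) =
    (y ∷ eₐ) , yeₐ∈H , extend-maps (extend-on newY) (vertices-below s (proj₁ (designated-edges s))) a-onto

special-copy : ∀ {k E a b} → Special k E a b → ∀ {n} (H : PartiteHypergraph k n) →
               k * n ^ (k ∸ 1) < numEdges H → ContainsCopy H (2 * k) E
special-copy base     H big = path-copy H big
special-copy (swap s) H big = special-copy s H big
special-copy (step {k} s) {n} H big =
  let (x , L , more , link) = branching-lemma (k * n ^ (k ∸ 1)) H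
                                (subst (_< numEdges H) (sym (threshold-step k n)) big)
  in extend-copy s H L x link (special-copy s L more)

mainTheorem4 : ∀ (k n : ℕ) → 2 ≤ k → 1 ≤ n →
    (E : List (List ℕ)) → InDk k E →
    (H : PartiteHypergraph k n) →
    k * n ^ (k ∸ 1) < numEdges H →
    ContainsCopy H (2 * k) E
mainTheorem4 k n _ _ E (a , b , s) H big = special-copy s H big
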